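{- Let $k\ge2$. For $0<i\le k$ and $N\ge0$ let $\mathcal E_{k,i}(N)=\sum a^{s}b^{t}q^{n}$, summed over all generalized Bressoud–Burge lattice paths with exactly $N$ peaks satisfying the odd $(k,i)$-conditions, where $s$, $t$, $n$ are the numbers of peaks marked by $a$, marked by $b$, and the major index. For $0\le i<k$ let $\Gamma_{k,i}(N)$ be the analogous generating function (same weights) for the objects obtained from the paths counted by $\mathcal E_{k,i+1}(N)$ that begin with an NE step by deleting this first NE step and shifting the remainder one unit to the left. Then for $N\ge1$: $\mathcal{E}_{k,i}(N) = q^N \Gamma_{k,i-1}(N) + q^N \mathcal{E}_{k,i+1}(N)$ for $0<i<k$; $\Gamma_{k,i}(N) = q^N \Gamma_{k,i-1}(N) + (a+b+q^{N-1}+abq^{1-N}) \mathcal{E}_{k,i+1}(N-1)$ for $0<i<k$; $\mathcal{E}_{k,k}(N) = q^N\Gamma_{k,k-1}(N) + q^N\mathcal{E}_{k,k}(N)$; and moreover $\mathcal{E}_{k,i}(0) = 1$ for $0<i\le k$ and $\Gamma_{k,0}(N) = 0$ for all $N$.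
   Context: Generalized Bressoud–Burge lattice paths: paths in the first quadrant starting on the $y$-axis and ending on the $x$-axis, with steps NE $(x,y)\to(x+1,y+1)$, SE $(x,y)\to(x+1,y-1)$, S $(x,y)\to(x,y-1)$, SW $(x,y)\to(x-1,y-1)$, E $(x,0)\to(x+1,0)$ (only at height 0), where S and SW steps may only occur immediately after an NE step (the path ends at its first arrival on the $x$-axis after its last peak, or at its first arrival on the $x$-axis if it has no peak). A peak is a vertex preceded by NE and followed by S (labelled $a$ or $b$: an $a$-peak or $b$-peak), by SW (an $ab$-peak), or by SE (a $1$-peak). Marked by $a$: $a$-peaks and $ab$-peaks; marked by $b$: $b$-peaks and $ab$-peaks. Major index: sum of the $x$-coordinates of the peaks. Odd $(k,i)$-conditions: the path starts at $(0,k-i)$ and its height is always $<k$. -}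

module Defs where

open import Data.Bool using (Bool; true; false; _∧_; _∨_; not; if_then_else_; T)
open import Data.Nat using (ℕ; zero; suc; _+_; _∸_; _≡ᵇ_; _<ᵇ_; _≤ᵇ_)
open import Data.Integer as ℤ using (ℤ; +_)
open import Data.List using (List; []; _∷_; _++_; length; map)
open import Data.Nat.ListAction using (sum)
open import Data.Product using (Σ; _×_; _,_)
open import Data.Fin using (Fin)
open import Function.Bundles using (_↔_)
open import Relation.Binary.PropositionalEquality using (_≡_)

-- Steps of a generalized Bressoud–Burge path.
-- S steps carry the label (a or b) of the peak they follow.

data Label : Set where
  la lb : Label

data Step : Set where
  NE SE E SW : Step
  S : Label → Step

-- coordinates after a step (only meaningful when the step is legal)
stepX : ℕ → Step → ℕ
stepX x NE    = suc x
stepX x SE    = suc x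
stepX x E     = suc x
stepX x SW    = x ∸ 1
stepX x (S _) = x

stepY : ℕ → Step → ℕ
stepY y NE    = suc y
stepY y SE    = y ∸ 1
stepY y E     = y
stepY y SW    = y ∸ 1
stepY y (S _) = y ∸ 1

legal : ℕ → ℕ → Step → Bool
legal x y NE    = true
legal x y SE    = 1 ≤ᵇ y
legal x y E     = y ≡ᵇ 0
legal x y SW    = (1 ≤ᵇ x) ∧ (1 ≤ᵇ y)
legal x y (S _) = 1 ≤ᵇ y

isNE : Step → Bool
isNE NE = true
isNE _  = false

needsNE : Step → Bool
needsNE SW    = true
needsNE (S _) = true
needsNE _     = false

-- steps that, following an NE step, make a peak
isDown : Step → Bool
isDown SE    = true
isDown SW    = true
isDown (S _) = true
isDown _     = false

startsDown : List Step → Bool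
startsDown []      = false
startsDown (s ∷ _) = isDown s

hasPeak : List Step → Bool
hasPeak []         = false
hasPeak (s ∷ rest) = (isNE s ∧ startsDown rest) ∨ hasPeak rest

-- valid k x y p ss : the path with steps ss starting at (x,y) (p = previous
-- step was NE) satisfies: stays in the first quadrant, height always < k,
-- E only at height 0, S/SW only right after NE, ends on the x-axis, and
-- every vertex on the x-axis other than the last one is followed by a peak
-- (i.e. the path ends at its first arrival on the x-axis after its last
-- peak, or at its first arrival if it has no peak).
valid : ℕ → ℕ → ℕ → Bool → List Step → Bool
valid k x y p []         = (y <ᵇ k) ∧ (y ≡ᵇ 0)
valid k x y p (s ∷ rest) =
  (y <ᵇ k) ∧ (not (y ≡ᵇ 0) ∨ hasPeak (s ∷ rest)) ∧ legal x y s
  ∧ (not (needsNE s) ∨ p) ∧ valid k (stepX x s) (stepY y s) (isNE s) rest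

data Kind : Set where
  ka kb kab k1 : Kind

kindOf : Step → Kind
kindOf (S la) = ka
kindOf (S lb) = kb
kindOf SW     = kab
kindOf _      = k1

record Peak : Set where
  constructor peak
  field
    px : ℕ
    pk : Kind
open Peak public

peakAt : ℕ → List Step → List Peak
peakAt x' []      = []
peakAt x' (d ∷ _) = if isDown d then peak x' (kindOf d) ∷ [] else []

peaks : ℕ → ℕ → List Step → List Peak
peaks x y []         = []
peaks x y (s ∷ rest) =
  (if isNE s then peakAt (stepX x s) rest else [])
  ++ peaks (stepX x s) (stepY y s) rest

markedA : Kind → Bool
markedA ka  = true
markedA kab = true
markedA _   = false

markedB : Kind → Bool
markedB kb  = true
markedB kab = true
markedB _   = false

countBy : (Kind → Bool) → List Peak → ℕ
countBy f []       = 0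
countBy f (p ∷ ps) = (if f (pk p) then 1 else 0) + countBy f ps

maj : List Peak → ℕ
maj ps = sum (map px ps)

-- paths with N peaks satisfying the odd (k,i)-conditions (start (0,k-i)),
-- with s peaks marked by a, t marked by b, major index n
EObj : ℕ → ℕ → ℕ → ℕ → ℕ → ℤ → Set
EObj k i N s t n = Σ (List Step) λ ss →
  let ps = peaks 0 (k ∸ i) ss in
  T (valid k 0 (k ∸ i) false ss) × length ps ≡ N
  × countBy markedA ps ≡ s × countBy markedB ps ≡ t × + maj ps ≡ n

-- Γ_{k,i}(N): a path NE ∷ rest counted by E_{k,i+1}(N) with the first NE
-- step deleted and the remainder shifted one unit left; its peaks are those
-- of the original path with x-coordinate decreased by 1 (the object is
-- represented by `rest`).
ΓObj : ℕ → ℕ → ℕ → ℕ → ℕ → ℤ → Set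
ΓObj k i N s t n = Σ (List Step) λ rest →
  let ps = peaks 0 (k ∸ suc i) (NE ∷ rest) in
  T (valid k 0 (k ∸ suc i) false (NE ∷ rest)) × length ps ≡ N
  × countBy markedA ps ≡ s × countBy markedB ps ≡ t
  × + sum (map (λ p → px p ∸ 1) ps) ≡ n

-- Generating functions in a, b (nonnegative powers) and q (integer powers),
-- represented by their coefficients: F s t n = [a^s b^t q^n] F.

GF : Set
GF = ℕ → ℕ → ℤ → ℕ

IsGF : GF → (ℕ → ℕ → ℤ → Set) → Set
IsGF F P = ∀ s t n → Fin (F s t n) ↔ P s t n

_≐_ : GF → GF → Set
F ≐ G = ∀ s t n → F s t n ≡ G s t n

infix 4 _≐_

zeroGF : GF
zeroGF s t n = 0

oneGF : GF
oneGF zero zero (+ zero) = 1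
oneGF _    _    _        = 0

_⊕_ : GF → GF → GF
(F ⊕ G) s t n = F s t n + G s t n

infixl 6 _⊕_

record Mono : Set where
  constructor mono
  field
    aExp : ℕ
    bExp : ℕ
    qExp : ℤ

monoMul : Mono → GF → GF
monoMul (mono i j m) F s t n =
  if (i ≤ᵇ s) ∧ (j ≤ᵇ t) then F (s ∸ i) (t ∸ j) (n ℤ.- m) else 0

_·_ : List Mono → GF → GF
([] · F)     = zeroGF
((m ∷ ms) · F) = monoMul m F ⊕ (ms · F)

infixl 7 _·_

q^ : ℤ → List Mono
q^ m = mono 0 0 m ∷ []

-- Each generating function counts the fibres of a weighted set of paths, so every identity
-- amounts to a weight-preserving bijection, obtained by looking at the first steps of a path.
-- A path counted by E_{k,i}(N) starts either with NE, and is then a Γ_{k,i-1} object once its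
-- N peaks are moved one unit left (the factor q^N), or with SE (E on the x-axis), after which
-- it is an E_{k,i+1} path moved one unit right (again q^N). In a Γ_{k,i} object the step after
-- the deleted NE is either NE, giving a Γ_{k,i-1} object (q^N), or the descent from a peak at x = 1.
-- That peak contributes a, b, 1 or ab, and the rest of the path is an E_{k,i+1} path with
-- N - 1 peaks moved by 0, 0, +1 or -1 relative to the Γ coordinates, whence the factor
-- a + b + q^(N-1) + ab q^(1-N). The only peakless path is SE^(k-i), and Γ_{k,0} is empty
-- because its NE step would reach height k.

module Submission where

open import Defs
open import Algebra.Bundles using (AbelianGroup)
open import Axiom.UniquenessOfIdentityProofs using (module Decidable⇒UIP)
open import Data.Bool using (Bool; true; false; _∧_; _∨_; not; if_then_else_; T)
open import Data.Bool.Properties using (T-∧; T-∨; T-irrelevant)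
open import Data.Empty using (⊥; ⊥-elim)
open import Data.Fin using (Fin)
open import Data.Fin.Permutation using (↔⇒≡)
open import Data.Fin.Properties using (1↔⊤; +↔⊎)
open import Data.Integer using (+_; _-_)
open import Data.Integer as ℤ using (ℤ)
import Data.Integer.Properties as ℤₚ
open import Data.Integer.Tactic.RingSolver using (solve-∀)
open import Data.List using (List; []; _∷_; _++_; length; map; replicate)
open import Data.List.Properties using (map-++; length-map)
open import Data.List.Relation.Unary.All using (All; []; _∷_)
open import Data.List.Relation.Unary.All.Properties using (++⁺)
open import Data.Nat using (ℕ; zero; suc; pred; _+_; _∸_; _≤_; _<_; _≡ᵇ_; _<ᵇ_; _≤ᵇ_; s≤s; z≤n)
open import Data.Nat.ListAction using (sum)
open import Data.Nat.Properties
  using (_≟_; ≡-irrelevant; suc-injective; +-suc; +-assoc; +-comm; +-cancelˡ-≡; m≤m+n; m+[n∸m]≡n;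
         ≤-refl; ≤ᵇ⇒≤; ≤⇒≤ᵇ; <ᵇ⇒<; <⇒<ᵇ; <-irrefl; <-trans; <⇒≤; n<1+n; n∸n≡0; ∸-monoʳ-<;
         pred[m∸n]≡m∸[1+n]; +-∸-assoc)
open import Data.Product using (Σ; _×_; _,_; proj₁; proj₂)
open import Data.Sum using (_⊎_; inj₁; inj₂; [_,_])
open import Data.Sum.Function.Propositional using (_⊎-↔_)
open import Data.Unit using (⊤; tt)
open import Function using (_∘_; id)
open import Function.Bundles using (_↔_; mk↔ₛ′; Equivalence)
open import Function.Properties.Inverse using (↔-trans; ↔-sym)
open import Relation.Binary.Definitions using (DecidableEquality)
open import Relation.Binary.PropositionalEquality
  using (_≡_; refl; sym; trans; cong; cong₂; subst; module ≡-Reasoning)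
open import Relation.Nullary using (¬_; yes; no)
open import Algebra.Properties.Group (AbelianGroup.group ℤₚ.+-0-abelianGroup)
  using () renaming (∙-cancelˡ to ℤ-+-cancelˡ)

open ≡-Reasoning

-- Monomials and weighted sets

mono-≡ : ∀ {a b c a′ b′ c′} → a ≡ a′ → b ≡ b′ → c ≡ c′ → mono a b c ≡ mono a′ b′ c′
mono-≡ refl refl refl = refl

mono-≡-components : ∀ {a b c s t n} (p : a ≡ s) (q : b ≡ t) (r : c ≡ n)
  → (cong Mono.aExp (mono-≡ p q r) , cong Mono.bExp (mono-≡ p q r) , cong Mono.qExp (mono-≡ p q r)) ≡ (p , q , r)
mono-≡-components refl refl refl = refl

_≟ᴹ_ : DecidableEquality Mono
mono a b c ≟ᴹ mono a′ b′ c′ with a ≟ a′ | b ≟ b′ | c ℤₚ.≟ c′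
... | yes a≡a′ | yes b≡b′ | yes c≡c′ = yes (mono-≡ a≡a′ b≡b′ c≡c′)
... | no a≢a′  | _        | _        = no (a≢a′ ∘ cong Mono.aExp)
... | yes _    | no b≢b′  | _        = no (b≢b′ ∘ cong Mono.bExp)
... | yes _    | yes _    | no c≢c′  = no (c≢c′ ∘ cong Mono.qExp)

≡-irrelevantᴹ : {μ ν : Mono} (p q : μ ≡ ν) → p ≡ q
≡-irrelevantᴹ = Decidable⇒UIP.≡-irrelevant _≟ᴹ_

infixr 7 _⊛_

_⊛_ : Mono → Mono → Mono
mono i j m ⊛ mono s t n = mono (i + s) (j + t) (m ℤ.+ n)

⊛-cancelˡ : ∀ μ {ν ν′} → μ ⊛ ν ≡ μ ⊛ ν′ → ν ≡ ν′
⊛-cancelˡ (mono i j m) e =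
  mono-≡ (+-cancelˡ-≡ i _ _ (cong Mono.aExp e)) (+-cancelˡ-≡ j _ _ (cong Mono.bExp e))
         (ℤ-+-cancelˡ m _ _ (cong Mono.qExp e))

m+[n-m]≡n : ∀ (m n : ℤ) → m ℤ.+ (n - m) ≡ n
m+[n-m]≡n = solve-∀

⊛-∸ : ∀ {i j s t} m n → i ≤ s → j ≤ t → mono i j m ⊛ mono (s ∸ i) (t ∸ j) (n - m) ≡ mono s t n
⊛-∸ m n i≤s j≤t = mono-≡ (m+[n∸m]≡n i≤s) (m+[n∸m]≡n j≤t) (m+[n-m]≡n m n)

record Weighted : Set₁ where
  field
    Carrier : Set
    weight  : Carrier → Mono

open Weighted public

Fiber : Weighted → Mono → Set
Fiber W μ = Σ (Carrier W) λ x → weight W x ≡ μ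

IsGFʷ : GF → Weighted → Set
IsGFʷ F W = IsGF F λ s t n → Fiber W (mono s t n)

infixl 6 _⊎ʷ_
infixr 7 _*ʷ_ _·ʷ_
infix 4 _≃ʷ_

_*ʷ_ : Mono → Weighted → Weighted
μ *ʷ W = record { Carrier = Carrier W ; weight = (μ ⊛_) ∘ weight W }

_⊎ʷ_ : Weighted → Weighted → Weighted
W ⊎ʷ V = record { Carrier = Carrier W ⊎ Carrier V ; weight = [ weight W , weight V ] }

⊥ʷ : Weighted
⊥ʷ = record { Carrier = ⊥ ; weight = λ () }

𝟙ʷ : Weighted
𝟙ʷ = record { Carrier = ⊤ ; weight = λ _ → mono 0 0 (+ 0) }

_·ʷ_ : List Mono → Weighted → Weighted
[]       ·ʷ W = ⊥ʷ
(μ ∷ μs) ·ʷ W = μ *ʷ W ⊎ʷ μs ·ʷ W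

record _≃ʷ_ (W V : Weighted) : Set where
  field
    to        : Carrier W → Carrier V
    from      : Carrier V → Carrier W
    to∘from   : ∀ y → to (from y) ≡ y
    from∘to   : ∀ x → from (to x) ≡ x
    weight-to : ∀ x → weight V (to x) ≡ weight W x

Fiber-≡ : ∀ {W μ} {u v : Fiber W μ} → proj₁ u ≡ proj₁ v → u ≡ v
Fiber-≡ {u = x , p} {.x , q} refl = cong (x ,_) (≡-irrelevantᴹ p q)

Fiber-≃ʷ : ∀ {W V μ} → W ≃ʷ V → Fiber W μ ↔ Fiber V μ
Fiber-≃ʷ {W} {V} e = mk↔ₛ′
  (λ (x , p) → to x , trans (weight-to x) p)
  (λ (y , p) → from y , trans (weight-from y) p)
  (λ _ → Fiber-≡ (to∘from _))
  (λ _ → Fiber-≡ (from∘to _))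
  where
    open _≃ʷ_ e
    weight-from : ∀ y → weight W (from y) ≡ weight V y
    weight-from y = trans (sym (weight-to (from y))) (cong (weight V) (to∘from y))

Fiber-⊎ : ∀ {W V μ} → Fiber (W ⊎ʷ V) μ ↔ (Fiber W μ ⊎ Fiber V μ)
Fiber-⊎ {W} {V} {μ} = mk↔ₛ′ split join
  (λ { (inj₁ _) → refl ; (inj₂ _) → refl })
  (λ { (inj₁ _ , _) → refl ; (inj₂ _ , _) → refl })
  where
    split : Fiber (W ⊎ʷ V) μ → Fiber W μ ⊎ Fiber V μ
    split (inj₁ x , p) = inj₁ (x , p)
    split (inj₂ y , p) = inj₂ (y , p)
    join : Fiber W μ ⊎ Fiber V μ → Fiber (W ⊎ʷ V) μ
    join (inj₁ (x , p)) = inj₁ x , p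
    join (inj₂ (y , p)) = inj₂ y , p

Fiber-*ʷ : ∀ {W} μ {ν ν′} → μ ⊛ ν ≡ ν′ → Fiber W ν ↔ Fiber (μ *ʷ W) ν′
Fiber-*ʷ μ e = mk↔ₛ′
  (λ (x , p) → x , trans (cong (μ ⊛_) p) e)
  (λ (x , p) → x , ⊛-cancelˡ μ (trans p (sym e)))
  (λ _ → Fiber-≡ refl)
  (λ _ → Fiber-≡ refl)

Fin0↔ : {A : Set} → ¬ A → Fin 0 ↔ A
Fin0↔ ¬a = mk↔ₛ′ (λ ()) (⊥-elim ∘ ¬a) (⊥-elim ∘ ¬a) (λ ())

Fin-if : ∀ b {x} {A : Set} → (T b → Fin x ↔ A) → (¬ T b → ¬ A) → Fin (if b then x else 0) ↔ A
Fin-if true  ifTrue _       = ifTrue tt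
Fin-if false _      ifFalse = Fin0↔ (ifFalse id)

IsGFʷ-unique : ∀ {F G W} → IsGFʷ F W → IsGFʷ G W → F ≐ G
IsGFʷ-unique hF hG s t n = ↔⇒≡ (↔-trans (hF s t n) (↔-sym (hG s t n)))

IsGFʷ-≃ʷ : ∀ {F W V} → IsGFʷ F W → W ≃ʷ V → IsGFʷ F V
IsGFʷ-≃ʷ hF e s t n = ↔-trans (hF s t n) (Fiber-≃ʷ e)

IsGFʷ-empty : ∀ {W} → ¬ Carrier W → IsGFʷ zeroGF W
IsGFʷ-empty ¬w s t n = Fin0↔ (¬w ∘ proj₁)

IsGFʷ-𝟙 : IsGFʷ oneGF 𝟙ʷ
IsGFʷ-𝟙 zero    zero    (+ zero)  =
  ↔-trans 1↔⊤ (mk↔ₛ′ (λ _ → tt , refl) (λ _ → tt) (λ _ → Fiber-≡ refl) (λ _ → refl))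
IsGFʷ-𝟙 zero    zero    (+ suc n) = Fin0↔ λ ()
IsGFʷ-𝟙 zero    zero    ℤ.-[1+ n ] = Fin0↔ λ ()
IsGFʷ-𝟙 zero    (suc t) n         = Fin0↔ λ ()
IsGFʷ-𝟙 (suc s) t       n         = Fin0↔ λ ()

IsGFʷ-⊕ : ∀ {F G W V} → IsGFʷ F W → IsGFʷ G V → IsGFʷ (F ⊕ G) (W ⊎ʷ V)
IsGFʷ-⊕ hF hG s t n = ↔-trans +↔⊎ (↔-trans (hF s t n ⊎-↔ hG s t n) (↔-sym Fiber-⊎))

IsGFʷ-monoMul : ∀ {F W} μ → IsGFʷ F W → IsGFʷ (monoMul μ F) (μ *ʷ W)
IsGFʷ-monoMul {F} {W} (mono i j m) hF s t n = Fin-if ((i ≤ᵇ s) ∧ (j ≤ᵇ t)) divisible indivisible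
  where
    divisible : T ((i ≤ᵇ s) ∧ (j ≤ᵇ t))
              → Fin (F (s ∸ i) (t ∸ j) (n - m)) ↔ Fiber (mono i j m *ʷ W) (mono s t n)
    divisible i,j≤s,t =
      ↔-trans (hF _ _ _) (Fiber-*ʷ (mono i j m) (⊛-∸ m n (≤ᵇ⇒≤ i s i≤s) (≤ᵇ⇒≤ j t j≤t)))
      where
        i≤s = proj₁ (Equivalence.to T-∧ i,j≤s,t)
        j≤t = proj₂ (Equivalence.to T-∧ i,j≤s,t)
    m+n≡o⇒m≤o : ∀ m {n o} → m + n ≡ o → m ≤ o
    m+n≡o⇒m≤o m {n} e = subst (m ≤_) e (m≤m+n m n)
    indivisible : ¬ T ((i ≤ᵇ s) ∧ (j ≤ᵇ t)) → ¬ Fiber (mono i j m *ʷ W) (mono s t n)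
    indivisible ¬i,j≤s,t (_ , e) = ¬i,j≤s,t (Equivalence.from (T-∧ {i ≤ᵇ s} {j ≤ᵇ t})
      (≤⇒≤ᵇ (m+n≡o⇒m≤o i (cong Mono.aExp e)) , ≤⇒≤ᵇ (m+n≡o⇒m≤o j (cong Mono.bExp e))))

IsGFʷ-· : ∀ {F W} μs → IsGFʷ F W → IsGFʷ (μs · F) (μs ·ʷ W)
IsGFʷ-· []       hF = IsGFʷ-empty λ ()
IsGFʷ-· (μ ∷ μs) hF = IsGFʷ-⊕ (IsGFʷ-monoMul μ hF) (IsGFʷ-· μs hF)

Positive : Peak → Set
Positive p = 1 ≤ px p

shiftPeak : Peak → Peak
shiftPeak (peak x κ) = peak (suc x) κ

leftMaj : List Peak → ℕ
leftMaj ps = sum (map (λ p → px p ∸ 1) ps)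

weightBy : (List Peak → ℕ) → List Peak → Mono
weightBy f ps = mono (countBy markedA ps) (countBy markedB ps) (+ f ps)

countBy-map-shift : ∀ f ps → countBy f (map shiftPeak ps) ≡ countBy f ps
countBy-map-shift f []              = refl
countBy-map-shift f (peak x κ ∷ ps) = cong (_+_ (if f κ then 1 else 0)) (countBy-map-shift f ps)

leftMaj-map-shift : ∀ ps → leftMaj (map shiftPeak ps) ≡ maj ps
leftMaj-map-shift []              = refl
leftMaj-map-shift (peak x κ ∷ ps) = cong (_+_ x) (leftMaj-map-shift ps)

map-shift-positive : ∀ ps → All Positive (map shiftPeak ps)
map-shift-positive []              = []
map-shift-positive (peak x κ ∷ ps) = s≤s z≤n ∷ map-shift-positive ps

leftMaj+length : ∀ {ps} → All Positive ps → leftMaj ps + length ps ≡ maj ps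
leftMaj+length {[]}                 []        = refl
leftMaj+length {peak (suc x) κ ∷ ps} (_ ∷ pos) = begin
  x + leftMaj ps + suc (length ps)    ≡⟨ +-suc (x + leftMaj ps) (length ps) ⟩
  suc (x + leftMaj ps + length ps)    ≡⟨ cong suc (+-assoc x (leftMaj ps) (length ps)) ⟩
  suc (x + (leftMaj ps + length ps))  ≡⟨ cong (suc ∘ _+_ x) (leftMaj+length pos) ⟩
  suc (x + maj ps)                    ∎

leftWeight-map-shift : ∀ ps → weightBy leftMaj (map shiftPeak ps) ≡ weightBy maj ps
leftWeight-map-shift ps =
  mono-≡ (countBy-map-shift markedA ps) (countBy-map-shift markedB ps) (cong +_ (leftMaj-map-shift ps))

weight-maj-leftMaj : ∀ {ps N} → All Positive ps → length ps ≡ N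
                   → mono 0 0 (+ N) ⊛ weightBy leftMaj ps ≡ weightBy maj ps
weight-maj-leftMaj {ps} pos refl =
  cong (mono (countBy markedA ps) (countBy markedB ps) ∘ +_) (trans (+-comm (length ps) (leftMaj ps)) (leftMaj+length pos))

weight-map-shift : ∀ ps {N} → length ps ≡ N → weightBy maj (map shiftPeak ps) ≡ mono 0 0 (+ N) ⊛ weightBy maj ps
weight-map-shift ps {N} l = begin
  weightBy maj (map shiftPeak ps)                       ≡⟨ sym (weight-maj-leftMaj (map-shift-positive ps) l′) ⟩
  mono 0 0 (+ N) ⊛ weightBy leftMaj (map shiftPeak ps)  ≡⟨ cong (mono 0 0 (+ N) ⊛_) (leftWeight-map-shift ps) ⟩
  mono 0 0 (+ N) ⊛ weightBy maj ps                      ∎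
  where l′ = trans (length-map shiftPeak ps) l

peakAt-suc : ∀ x r → peakAt (suc x) r ≡ map shiftPeak (peakAt x r)
peakAt-suc x []      = refl
peakAt-suc x (d ∷ _) with isDown d
... | true  = refl
... | false = refl

peakAt-positive : ∀ x r → All Positive (peakAt (suc x) r)
peakAt-positive x []      = []
peakAt-positive x (d ∷ _) with isDown d
... | true  = s≤s z≤n ∷ []
... | false = []

peaks-positive : ∀ x y ss → All Positive (peaks x y ss)
peaks-positive x y []         = []
peaks-positive x y (NE ∷ r)   = ++⁺ (peakAt-positive x r) (peaks-positive (suc x) (suc y) r)
peaks-positive x y (SE ∷ r)   = peaks-positive (suc x) (y ∸ 1) r
peaks-positive x y (E ∷ r)    = peaks-positive (suc x) y r
peaks-positive x y (SW ∷ r)   = peaks-positive (x ∸ 1) (y ∸ 1) r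
peaks-positive x y (S _ ∷ r)  = peaks-positive x (y ∸ 1) r

peaks-hasPeak : ∀ x y ss → 0 < length (peaks x y ss) → T (hasPeak ss)
peaks-hasPeak x y []              ()
peaks-hasPeak x y (NE ∷ [])       ()
peaks-hasPeak x y (NE ∷ NE ∷ r)   = peaks-hasPeak (suc x) (suc y) (NE ∷ r)
peaks-hasPeak x y (NE ∷ E ∷ r)    = peaks-hasPeak (suc x) (suc y) (E ∷ r)
peaks-hasPeak x y (NE ∷ SE ∷ r)   _ = tt
peaks-hasPeak x y (NE ∷ SW ∷ r)   _ = tt
peaks-hasPeak x y (NE ∷ S _ ∷ r)  _ = tt
peaks-hasPeak x y (SE ∷ r)        = peaks-hasPeak (suc x) (y ∸ 1) r
peaks-hasPeak x y (E ∷ r)         = peaks-hasPeak (suc x) y r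
peaks-hasPeak x y (SW ∷ r)        = peaks-hasPeak (x ∸ 1) (y ∸ 1) r
peaks-hasPeak x y (S _ ∷ r)       = peaks-hasPeak x (y ∸ 1) r

-- Unlike the Boolean `valid`, this record type determines its indices, so Agda can infer them.
record Valid (k x y : ℕ) (p : Bool) (ss : List Step) : Set where
  constructor mkValid
  field isValid : T (valid k x y p ss)

open Valid

Valid-irrelevant : ∀ {k x y p ss} (u v : Valid k x y p ss) → u ≡ v
Valid-irrelevant (mkValid u) (mkValid v) = cong mkValid (T-irrelevant u v)

record ValidStep (k x y : ℕ) (p : Bool) (s : Step) (r : List Step) : Set where
  field
    below     : T (y <ᵇ k)
    grounded  : T (not (y ≡ᵇ 0) ∨ hasPeak (s ∷ r))
    legalStep : T (legal x y s)
    afterNE   : T (not (needsNE s) ∨ p)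
    validTail : Valid k (stepX x s) (stepY y s) (isNE s) r

open ValidStep

valid-∷⁻ : ∀ {k x y p s r} → Valid k x y p (s ∷ r) → ValidStep k x y p s r
valid-∷⁻ (mkValid v) =
  let b , v₁ = Equivalence.to T-∧ v
      g , v₂ = Equivalence.to T-∧ v₁
      ℓ , v₃ = Equivalence.to T-∧ v₂
      a , t  = Equivalence.to T-∧ v₃
  in record { below = b ; grounded = g ; legalStep = ℓ ; afterNE = a ; validTail = mkValid t }

valid-∷⁺ : ∀ {k x y p s r} → ValidStep k x y p s r → Valid k x y p (s ∷ r)
valid-∷⁺ v = mkValid (Equivalence.from T-∧ (below v , Equivalence.from T-∧ (grounded v ,
  Equivalence.from T-∧ (legalStep v , Equivalence.from T-∧ (afterNE v , isValid (validTail v))))))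

valid-tail : ∀ {k x y p s r} → Valid k x y p (s ∷ r) → Valid k (stepX x s) (stepY y s) (isNE s) r
valid-tail = validTail ∘ valid-∷⁻

valid-[]⁻ : ∀ {k x y p} → Valid k x y p [] → T (y ≡ᵇ 0)
valid-[]⁻ (mkValid v) = proj₂ (Equivalence.to T-∧ v)

valid-below : ∀ {k x y p ss} → Valid k x y p ss → y < k
valid-below {k} {y = y} {ss = []}    (mkValid v) = <ᵇ⇒< y k (proj₁ (Equivalence.to T-∧ v))
valid-below {k} {y = y} {ss = _ ∷ _} v           = <ᵇ⇒< y k (below (valid-∷⁻ v))

valid-NE-after : ∀ {k x y p q r} → Valid k x y p (NE ∷ r) → Valid k x y q (NE ∷ r)
valid-NE-after = mkValid ∘ isValid

valid-∷-moved : ∀ {k x x′ y p s r} → ValidStep k x y p s r → T (legal x′ y s)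
              → Valid k (stepX x′ s) (stepY y s) (isNE s) r → Valid k x′ y p (s ∷ r)
valid-∷-moved w ℓ t =
  valid-∷⁺ record { below = below w ; grounded = grounded w ; legalStep = ℓ ; afterNE = afterNE w ; validTail = t }

-- Validity does not depend on the x-coordinate, except that SW, allowed only after NE (p), needs x ≥ 1.
valid-suc⁺ : ∀ {k x y p ss} → (T p → 0 < x) → Valid k x y p ss → Valid k (suc x) y p ss
valid-suc⁺ {ss = []}          _ v = mkValid (isValid v)
valid-suc⁺ {ss = NE ∷ _}      _ v =
  let w = valid-∷⁻ v in valid-∷-moved w tt (valid-suc⁺ (λ _ → s≤s z≤n) (validTail w))
valid-suc⁺ {ss = SE ∷ _}      _ v =
  let w = valid-∷⁻ v in valid-∷-moved w (legalStep w) (valid-suc⁺ (λ ()) (validTail w))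
valid-suc⁺ {ss = E ∷ _}       _ v =
  let w = valid-∷⁻ v in valid-∷-moved w (legalStep w) (valid-suc⁺ (λ ()) (validTail w))
valid-suc⁺ {ss = S _ ∷ _}     _ v =
  let w = valid-∷⁻ v in valid-∷-moved w (legalStep w) (valid-suc⁺ (λ ()) (validTail w))
valid-suc⁺ {x = suc _} {p = true} {SW ∷ _} _ v =
  let w = valid-∷⁻ v in valid-∷-moved w (legalStep w) (valid-suc⁺ (λ ()) (validTail w))
valid-suc⁺ {x = zero}  {p = true} {SW ∷ _} 0<x _ with 0<x tt
... | ()
valid-suc⁺ {p = false} {ss = SW ∷ _} _ v = ⊥-elim (afterNE (valid-∷⁻ v))

valid-suc⁻ : ∀ {k x y p ss} → (T p → 0 < x) → Valid k (suc x) y p ss → Valid k x y p ss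
valid-suc⁻ {ss = []}          _ v = mkValid (isValid v)
valid-suc⁻ {ss = NE ∷ _}      _ v =
  let w = valid-∷⁻ v in valid-∷-moved w tt (valid-suc⁻ (λ _ → s≤s z≤n) (validTail w))
valid-suc⁻ {ss = SE ∷ _}      _ v =
  let w = valid-∷⁻ v in valid-∷-moved w (legalStep w) (valid-suc⁻ (λ ()) (validTail w))
valid-suc⁻ {ss = E ∷ _}       _ v =
  let w = valid-∷⁻ v in valid-∷-moved w (legalStep w) (valid-suc⁻ (λ ()) (validTail w))
valid-suc⁻ {ss = S _ ∷ _}     _ v =
  let w = valid-∷⁻ v in valid-∷-moved w (legalStep w) (valid-suc⁻ (λ ()) (validTail w))
valid-suc⁻ {x = suc _} {p = true} {SW ∷ _} _ v =
  let w = valid-∷⁻ v in valid-∷-moved w (legalStep w) (valid-suc⁻ (λ ()) (validTail w))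
valid-suc⁻ {x = zero}  {p = true} {SW ∷ _} 0<x _ with 0<x tt
... | ()
valid-suc⁻ {p = false} {ss = SW ∷ _} _ v = ⊥-elim (afterNE (valid-∷⁻ v))

peaks-suc : ∀ {k x y p ss} → (T p → 0 < x) → Valid k x y p ss → peaks (suc x) y ss ≡ map shiftPeak (peaks x y ss)
peaks-suc {ss = []} _ _ = refl
peaks-suc {x = x} {y} {ss = NE ∷ r} _ v = begin
  peakAt (suc (suc x)) r ++ peaks (suc (suc x)) (suc y) r
    ≡⟨ cong₂ _++_ (peakAt-suc (suc x) r) (peaks-suc (λ _ → s≤s z≤n) (valid-tail v)) ⟩
  map shiftPeak (peakAt (suc x) r) ++ map shiftPeak (peaks (suc x) (suc y) r)
    ≡⟨ sym (map-++ shiftPeak (peakAt (suc x) r) _) ⟩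
  map shiftPeak (peakAt (suc x) r ++ peaks (suc x) (suc y) r) ∎
peaks-suc {ss = SE ∷ _}  _ v = peaks-suc (λ ()) (valid-tail v)
peaks-suc {ss = E ∷ _}   _ v = peaks-suc (λ ()) (valid-tail v)
peaks-suc {ss = S _ ∷ _} _ v = peaks-suc (λ ()) (valid-tail v)
peaks-suc {x = suc _} {ss = SW ∷ _} _ v = peaks-suc (λ ()) (valid-tail v)
peaks-suc {x = zero}  {ss = SW ∷ _} 0<x v with 0<x (afterNE (valid-∷⁻ v))
... | ()

weight-peaks-suc : ∀ {k x y N} ss → Valid k x y false ss → length (peaks x y ss) ≡ N
                 → weightBy maj (peaks (suc x) y ss) ≡ mono 0 0 (+ N) ⊛ weightBy maj (peaks x y ss)
weight-peaks-suc {x = x} {y} ss v l = trans (cong (weightBy maj) (peaks-suc (λ ()) v)) (weight-map-shift (peaks x y ss) l)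

leftWeight-peaks-suc : ∀ {k x y} ss → Valid k x y false ss
                     → weightBy leftMaj (peaks (suc x) y ss) ≡ weightBy maj (peaks x y ss)
leftWeight-peaks-suc {x = x} {y} ss v =
  trans (cong (weightBy leftMaj) (peaks-suc (λ ()) v)) (leftWeight-map-shift (peaks x y ss))

length-peaks-suc : ∀ {k x y ss} → Valid k x y false ss → length (peaks (suc x) y ss) ≡ length (peaks x y ss)
length-peaks-suc {x = x} {y} {ss} v = trans (cong length (peaks-suc (λ ()) v)) (length-map shiftPeak (peaks x y ss))

peaks-NE : ∀ {k x y p r} → Valid k x y p (NE ∷ r) → ¬ length (peaks x y (NE ∷ r)) ≡ 0
peaks-NE {r = []}     v _ = valid-[]⁻ (valid-tail v)
peaks-NE {r = NE ∷ _} v l = peaks-NE (valid-tail v) l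
peaks-NE {r = E ∷ _}  v _ = legalStep (valid-∷⁻ (valid-tail v))
peaks-NE {r = SE ∷ _}  _ ()
peaks-NE {r = SW ∷ _}  _ ()
peaks-NE {r = S _ ∷ _} _ ()

no-peaks : ∀ {k x y ss} → Valid k x y false ss → length (peaks x y ss) ≡ 0 → ss ≡ replicate y SE
no-peaks {y = zero}  {[]} _ _ = refl
no-peaks {y = suc _} {[]} v _ = ⊥-elim (valid-[]⁻ v)
no-peaks {ss = NE ∷ _} v l = ⊥-elim (peaks-NE v l)
no-peaks {y = zero}  {SE ∷ _} v _ = ⊥-elim (legalStep (valid-∷⁻ v))
no-peaks {y = suc _} {SE ∷ _} v l = cong (SE ∷_) (no-peaks (valid-tail v) l)
no-peaks {y = suc _} {E ∷ _}  v _ = ⊥-elim (legalStep (valid-∷⁻ v))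
no-peaks {y = zero}  {E ∷ _}  v l with no-peaks (valid-tail v) l
... | refl = ⊥-elim (grounded (valid-∷⁻ v))
no-peaks {ss = SW ∷ _}  v _ = ⊥-elim (afterNE (valid-∷⁻ v))
no-peaks {ss = S _ ∷ _} v _ = ⊥-elim (afterNE (valid-∷⁻ v))

valid-descent : ∀ {k x y} → y < k → Valid k x y false (replicate y SE)
valid-descent {y = zero}  y<k = mkValid (Equivalence.from T-∧ (<⇒<ᵇ y<k , tt))
valid-descent {y = suc y} y<k = valid-∷⁺ record
  { below = <⇒<ᵇ y<k ; grounded = tt ; legalStep = tt ; afterNE = tt
  ; validTail = valid-descent {y = y} (<-trans (n<1+n y) y<k) }

peaks-descent : ∀ x y → peaks x y (replicate y SE) ≡ []
peaks-descent x zero    = refl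
peaks-descent x (suc y) = peaks-descent (suc x) y

-- `start r` is the path itself: E paths have start = id, Γ objects are the steps after the deleted NE.
PathSet : ℕ → ℕ → (List Step → List Step) → ℕ → Set
PathSet k y start N = Σ (List Step) λ r → Valid k 0 y false (start r) × length (peaks 0 y (start r)) ≡ N

PathsWith : ℕ → ℕ → (List Step → List Step) → (List Peak → ℕ) → ℕ → Weighted
PathsWith k y start f N = record
  { Carrier = PathSet k y start N
  ; weight  = λ (r , _) → weightBy f (peaks 0 y (start r)) }

Paths : ℕ → ℕ → ℕ → Weighted
Paths k y = PathsWith k y id maj

ΓPaths : ℕ → ℕ → ℕ → Weighted
ΓPaths k y = PathsWith k y (NE ∷_) leftMaj

Path-≡ : ∀ {k y start N} {u v : PathSet k y start N} → proj₁ u ≡ proj₁ v → u ≡ v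
Path-≡ {u = r , v , l} {.r , v′ , l′} refl =
  cong₂ (λ v l → r , v , l) (Valid-irrelevant v v′) (≡-irrelevant l l′)

Obj : ℕ → ℕ → (List Step → List Step) → (List Peak → ℕ) → ℕ → ℕ → ℕ → ℤ → Set
Obj k y start f N s t n = Σ (List Step) λ r → let ps = peaks 0 y (start r) in
  T (valid k 0 y false (start r)) × length ps ≡ N
  × countBy markedA ps ≡ s × countBy markedB ps ≡ t × + f ps ≡ n

Obj↔Fiber : ∀ {k y start f N s t n} → Obj k y start f N s t n ↔ Fiber (PathsWith k y start f N) (mono s t n)
Obj↔Fiber = mk↔ₛ′
  (λ (r , v , l , a , b , m) → (r , mkValid v , l) , mono-≡ a b m)
  (λ ((r , v , l) , e) → r , isValid v , l , cong Mono.aExp e , cong Mono.bExp e , cong Mono.qExp e)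
  (λ _ → Fiber-≡ refl)
  (λ (r , v , l , a , b , m) → cong (λ (a , b , m) → r , v , l , a , b , m) (mono-≡-components a b m))

IsGFʷ-Obj : ∀ {F k y start f N} → IsGF F (Obj k y start f N) → IsGFʷ F (PathsWith k y start f N)
IsGFʷ-Obj {f = f} hF s t n = ↔-trans (hF s t n) (Obj↔Fiber {f = f})

zero-peaks : ∀ {k y} → y < k → 𝟙ʷ ≃ʷ Paths k y 0
zero-peaks {k} {y} y<k = record
  { to        = λ _ → replicate y SE , valid-descent y<k , cong length (peaks-descent 0 y)
  ; from      = λ _ → tt
  ; to∘from   = λ (_ , v , l) → Path-≡ (sym (no-peaks v l))
  ; from∘to   = λ _ → refl
  ; weight-to = λ _ → cong (weightBy maj) (peaks-descent 0 y) }

ΓPaths-top-empty : ∀ {k N} → ¬ Carrier (ΓPaths (suc k) k N)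
ΓPaths-top-empty (_ , v , _) = <-irrefl refl (valid-below (valid-tail v))

-- The first-step decompositions

module _ {k N : ℕ} where
  private
    Split : ℕ → Weighted
    Split h = q^ (+ N) ·ʷ ΓPaths k h N ⊎ʷ q^ (+ N) ·ʷ Paths k (pred h) N

    join : ∀ h → h < k → 1 ≤ N → Carrier (Split h) → Carrier (Paths k h N)
    join h _ _ (inj₁ (inj₁ (r , v , l))) = NE ∷ r , v , l
    join zero h<k 1≤N (inj₂ (inj₁ (r , v , l))) = E ∷ r , valid-∷⁺ record
      { below = <⇒<ᵇ h<k ; grounded = peaks-hasPeak 1 0 r (subst (0 <_) (sym l′) 1≤N)
      ; legalStep = tt ; afterNE = tt ; validTail = valid-suc⁺ (λ ()) v } , l′
      where l′ = trans (length-peaks-suc v) l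
    join (suc _) h<k _ (inj₂ (inj₁ (r , v , l))) = SE ∷ r , valid-∷⁺ record
      { below = <⇒<ᵇ h<k ; grounded = tt ; legalStep = tt ; afterNE = tt ; validTail = valid-suc⁺ (λ ()) v }
      , trans (length-peaks-suc v) l

    split : ∀ h → 1 ≤ N → Carrier (Paths k h N) → Carrier (Split h)
    split _       _   (NE ∷ r , v , l)  = inj₁ (inj₁ (r , v , l))
    split zero    _   (E ∷ r , v , l)   = let v′ = valid-suc⁻ (λ ()) (valid-tail v) in
      inj₂ (inj₁ (r , v′ , trans (sym (length-peaks-suc v′)) l))
    split (suc _) _   (SE ∷ r , v , l)  = let v′ = valid-suc⁻ (λ ()) (valid-tail v) in
      inj₂ (inj₁ (r , v′ , trans (sym (length-peaks-suc v′)) l))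
    split zero    1≤N ([] , _ , l)      = ⊥-elim (<-irrefl refl (subst (1 ≤_) (sym l) 1≤N))
    split (suc _) _   ([] , v , _)      = ⊥-elim (valid-[]⁻ v)
    split zero    _   (SE ∷ _ , v , _)  = ⊥-elim (legalStep (valid-∷⁻ v))
    split (suc _) _   (E ∷ _ , v , _)   = ⊥-elim (legalStep (valid-∷⁻ v))
    split _       _   (SW ∷ _ , v , _)  = ⊥-elim (afterNE (valid-∷⁻ v))
    split _       _   (S _ ∷ _ , v , _) = ⊥-elim (afterNE (valid-∷⁻ v))

    join∘split : ∀ h h<k 1≤N w → join h h<k 1≤N (split h 1≤N w) ≡ w
    join∘split _       _ _   (NE ∷ _ , _)      = refl
    join∘split zero    _ _   (E ∷ _ , _)       = Path-≡ refl
    join∘split (suc _) _ _   (SE ∷ _ , _)      = Path-≡ refl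
    join∘split zero    _ 1≤N ([] , _ , l)      = ⊥-elim (<-irrefl refl (subst (1 ≤_) (sym l) 1≤N))
    join∘split (suc _) _ _   ([] , v , _)      = ⊥-elim (valid-[]⁻ v)
    join∘split zero    _ _   (SE ∷ _ , v , _)  = ⊥-elim (legalStep (valid-∷⁻ v))
    join∘split (suc _) _ _   (E ∷ _ , v , _)   = ⊥-elim (legalStep (valid-∷⁻ v))
    join∘split _       _ _   (SW ∷ _ , v , _)  = ⊥-elim (afterNE (valid-∷⁻ v))
    join∘split _       _ _   (S _ ∷ _ , v , _) = ⊥-elim (afterNE (valid-∷⁻ v))

    split∘join : ∀ h h<k 1≤N z → split h 1≤N (join h h<k 1≤N z) ≡ z
    split∘join _       _ _ (inj₁ (inj₁ _)) = refl
    split∘join zero    _ _ (inj₂ (inj₁ _)) = cong (inj₂ ∘ inj₁) (Path-≡ refl)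
    split∘join (suc _) _ _ (inj₂ (inj₁ _)) = cong (inj₂ ∘ inj₁) (Path-≡ refl)

    weight-join : ∀ h h<k 1≤N z → weight (Paths k h N) (join h h<k 1≤N z) ≡ weight (Split h) z
    weight-join h _ _ (inj₁ (inj₁ (r , _ , l))) = sym (weight-maj-leftMaj (peaks-positive 0 h (NE ∷ r)) l)
    weight-join zero    _ _ (inj₂ (inj₁ (r , v , l))) = weight-peaks-suc r v l
    weight-join (suc _) _ _ (inj₂ (inj₁ (r , v , l))) = weight-peaks-suc r v l

  E-split : ∀ h → h < k → 1 ≤ N
          → q^ (+ N) ·ʷ ΓPaths k h N ⊎ʷ q^ (+ N) ·ʷ Paths k (pred h) N ≃ʷ Paths k h N
  E-split h h<k 1≤N = record
    { to = join h h<k 1≤N ; from = split h 1≤N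
    ; to∘from = join∘split h h<k 1≤N ; from∘to = split∘join h h<k 1≤N ; weight-to = weight-join h h<k 1≤N }

valid-NE∷ : ∀ {k y r} → y < k → T (hasPeak (NE ∷ r)) → Valid k 1 (suc y) true r → Valid k 0 y false (NE ∷ r)
valid-NE∷ {y = y} y<k peaked v = valid-∷⁺ record
  { below = <⇒<ᵇ y<k ; grounded = Equivalence.from (T-∨ {not (y ≡ᵇ 0)}) (inj₂ peaked)
  ; legalStep = tt ; afterNE = tt ; validTail = v }

valid-peak : ∀ {k y r} d → T (isDown d) → suc y < k
           → Valid k (stepX 1 d) (stepY (suc y) d) false r → Valid k 0 y false (NE ∷ d ∷ r)
valid-peak {y = y} SE    _ y<k v = valid-NE∷ (<-trans (n<1+n y) y<k) tt
  (valid-∷⁺ record { below = <⇒<ᵇ y<k ; grounded = tt ; legalStep = tt ; afterNE = tt ; validTail = v })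
valid-peak {y = y} SW    _ y<k v = valid-NE∷ (<-trans (n<1+n y) y<k) tt
  (valid-∷⁺ record { below = <⇒<ᵇ y<k ; grounded = tt ; legalStep = tt ; afterNE = tt ; validTail = v })
valid-peak {y = y} (S _) _ y<k v = valid-NE∷ (<-trans (n<1+n y) y<k) tt
  (valid-∷⁺ record { below = <⇒<ᵇ y<k ; grounded = tt ; legalStep = tt ; afterNE = tt ; validTail = v })

-- The factor a + b + q^(N-1) + ab q^(1-N) of the recurrence for Γ_{k,i}(N), taken at N + 1.
peakFactor : ℕ → List Mono
peakFactor N = mono 1 0 (+ 0) ∷ mono 0 1 (+ 0) ∷ mono 0 0 (+ N) ∷ mono 1 1 (+ 1 - + suc N) ∷ []

m≡[1-[1+n]]+[m+n] : ∀ (m n : ℤ) → m ≡ (+ 1 - (+ 1 ℤ.+ n)) ℤ.+ (m ℤ.+ n)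
m≡[1-[1+n]]+[m+n] = solve-∀

module _ {k y N : ℕ} where
  private
    Split : Weighted
    Split = q^ (+ suc N) ·ʷ ΓPaths k (suc y) (suc N) ⊎ʷ peakFactor N ·ʷ Paths k y N

    join : suc y < k → Carrier Split → Carrier (ΓPaths k y (suc N))
    join y<k (inj₁ (inj₁ (r , v , l))) =
      NE ∷ r , valid-NE∷ (<-trans (n<1+n y) y<k) (peaks-hasPeak 0 (suc y) (NE ∷ r) (subst (0 <_) (sym l) (s≤s z≤n)))
                         (valid-NE-after (valid-suc⁺ (λ ()) v))
             , trans (length-peaks-suc v) l
    join y<k (inj₂ (inj₁ (r , v , l))) =
      S la ∷ r , valid-peak (S la) tt y<k (valid-suc⁺ (λ ()) v) , cong suc (trans (length-peaks-suc v) l)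
    join y<k (inj₂ (inj₂ (inj₁ (r , v , l)))) =
      S lb ∷ r , valid-peak (S lb) tt y<k (valid-suc⁺ (λ ()) v) , cong suc (trans (length-peaks-suc v) l)
    join y<k (inj₂ (inj₂ (inj₂ (inj₁ (r , v , l))))) =
      SE ∷ r , valid-peak SE tt y<k (valid-suc⁺ (λ ()) v₁)
             , cong suc (trans (length-peaks-suc v₁) (trans (length-peaks-suc v) l))
      where v₁ = valid-suc⁺ (λ ()) v
    join y<k (inj₂ (inj₂ (inj₂ (inj₂ (inj₁ (r , v , l)))))) =
      SW ∷ r , valid-peak SW tt y<k v , cong suc l

    split : Carrier (ΓPaths k y (suc N)) → Carrier Split
    split (NE ∷ r , v , l) = inj₁ (inj₁ (r , v₀ , trans (sym (length-peaks-suc v₀)) l))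
      where v₀ = valid-suc⁻ (λ ()) (valid-NE-after (valid-tail v))
    split (S la ∷ r , v , l) = inj₂ (inj₁ (r , v₀ , trans (sym (length-peaks-suc v₀)) (suc-injective l)))
      where v₀ = valid-suc⁻ (λ ()) (valid-tail (valid-tail v))
    split (S lb ∷ r , v , l) = inj₂ (inj₂ (inj₁ (r , v₀ , trans (sym (length-peaks-suc v₀)) (suc-injective l))))
      where v₀ = valid-suc⁻ (λ ()) (valid-tail (valid-tail v))
    split (SE ∷ r , v , l) =
      inj₂ (inj₂ (inj₂ (inj₁ (r , v₀ ,
        trans (sym (length-peaks-suc v₀)) (trans (sym (length-peaks-suc v₁)) (suc-injective l))))))
      where v₁ = valid-suc⁻ (λ ()) (valid-tail (valid-tail v))
            v₀ = valid-suc⁻ (λ ()) v₁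
    split (SW ∷ r , v , l) = inj₂ (inj₂ (inj₂ (inj₂ (inj₁ (r , valid-tail (valid-tail v) , suc-injective l)))))
    split ([] , v , _)    = ⊥-elim (valid-[]⁻ (valid-tail v))
    split (E ∷ _ , v , _) = ⊥-elim (legalStep (valid-∷⁻ (valid-tail v)))

    join∘split : ∀ y<k w → join y<k (split w) ≡ w
    join∘split _ (NE ∷ _ , _)   = Path-≡ refl
    join∘split _ (S la ∷ _ , _) = Path-≡ refl
    join∘split _ (S lb ∷ _ , _) = Path-≡ refl
    join∘split _ (SE ∷ _ , _)   = Path-≡ refl
    join∘split _ (SW ∷ _ , _)   = Path-≡ refl
    join∘split _ ([] , v , _)    = ⊥-elim (valid-[]⁻ (valid-tail v))
    join∘split _ (E ∷ _ , v , _) = ⊥-elim (legalStep (valid-∷⁻ (valid-tail v)))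

    split∘join : ∀ y<k z → split (join y<k z) ≡ z
    split∘join _ (inj₁ (inj₁ _))                         = cong (inj₁ ∘ inj₁) (Path-≡ refl)
    split∘join _ (inj₂ (inj₁ _))                         = cong (inj₂ ∘ inj₁) (Path-≡ refl)
    split∘join _ (inj₂ (inj₂ (inj₁ _)))                  = cong (inj₂ ∘ inj₂ ∘ inj₁) (Path-≡ refl)
    split∘join _ (inj₂ (inj₂ (inj₂ (inj₁ _))))           = cong (inj₂ ∘ inj₂ ∘ inj₂ ∘ inj₁) (Path-≡ refl)
    split∘join _ (inj₂ (inj₂ (inj₂ (inj₂ (inj₁ _)))))    = cong (inj₂ ∘ inj₂ ∘ inj₂ ∘ inj₂ ∘ inj₁) (Path-≡ refl)

    weight-join : ∀ y<k z → weight (ΓPaths k y (suc N)) (join y<k z) ≡ weight Split z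
    weight-join _ (inj₁ (inj₁ (r , v , l))) =
      trans (leftWeight-peaks-suc (NE ∷ r) v) (sym (weight-maj-leftMaj (peaks-positive 0 (suc y) (NE ∷ r)) l))
    weight-join _ (inj₂ (inj₁ (r , v , _)))        = cong (mono 1 0 (+ 0) ⊛_) (leftWeight-peaks-suc r v)
    weight-join _ (inj₂ (inj₂ (inj₁ (r , v , _)))) = cong (mono 0 1 (+ 0) ⊛_) (leftWeight-peaks-suc r v)
    weight-join _ (inj₂ (inj₂ (inj₂ (inj₁ (r , v , l))))) =
      trans (leftWeight-peaks-suc r (valid-suc⁺ (λ ()) v)) (weight-peaks-suc r v l)
    weight-join _ (inj₂ (inj₂ (inj₂ (inj₂ (inj₁ (r , _ , l)))))) =
      cong (mono (suc (countBy markedA ps)) (suc (countBy markedB ps))) (begin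
        + leftMaj ps                                      ≡⟨ m≡[1-[1+n]]+[m+n] (+ leftMaj ps) (+ N) ⟩
        (+ 1 - + suc N) ℤ.+ + (leftMaj ps + N)            ≡⟨ cong (λ m → (+ 1 - + suc N) ℤ.+ + m) majority ⟩
        (+ 1 - + suc N) ℤ.+ + maj ps                      ∎)
      where
        ps = peaks 0 y r
        majority : leftMaj ps + N ≡ maj ps
        majority = trans (cong (_+_ (leftMaj ps)) (sym l)) (leftMaj+length (peaks-positive 0 y r))

  Γ-split : suc y < k
          → q^ (+ suc N) ·ʷ ΓPaths k (suc y) (suc N) ⊎ʷ peakFactor N ·ʷ Paths k y N ≃ʷ ΓPaths k y (suc N)
  Γ-split y<k = record
    { to = join y<k ; from = split
    ; to∘from = join∘split y<k ; from∘to = split∘join y<k ; weight-to = weight-join y<k }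

E-recurrence : ∀ {k h N F G H} → h < k → 1 ≤ N
  → IsGFʷ F (Paths k h N) → IsGFʷ G (ΓPaths k h N) → IsGFʷ H (Paths k (pred h) N)
  → F ≐ q^ (+ N) · G ⊕ q^ (+ N) · H
E-recurrence {h = h} {N} h<k 1≤N hF hG hH =
  IsGFʷ-unique hF (IsGFʷ-≃ʷ (IsGFʷ-⊕ (IsGFʷ-· (q^ (+ N)) hG) (IsGFʷ-· (q^ (+ N)) hH)) (E-split h h<k 1≤N))

Γ-recurrence : ∀ {k y N F G H} → suc y < k
  → IsGFʷ F (ΓPaths k y (suc N)) → IsGFʷ G (ΓPaths k (suc y) (suc N)) → IsGFʷ H (Paths k y N)
  → F ≐ q^ (+ suc N) · G ⊕ peakFactor N · H
Γ-recurrence {N = N} y<k hF hG hH =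
  IsGFʷ-unique hF (IsGFʷ-≃ʷ (IsGFʷ-⊕ (IsGFʷ-· (q^ (+ suc N)) hG) (IsGFʷ-· (peakFactor N) hH)) (Γ-split y<k))

proposition2 : (k : ℕ) → 2 ≤ k → (E Γ : ℕ → ℕ → GF)
    → (∀ i N → 0 < i → i ≤ k → IsGF (E i N) (EObj k i N))
    → (∀ i N → i < k → IsGF (Γ i N) (ΓObj k i N))
    → (∀ i N → 0 < i → i < k → 1 ≤ N →
         E i N ≐ q^ (+ N) · Γ (i ∸ 1) N ⊕ q^ (+ N) · E (suc i) N)
    × (∀ i N → 0 < i → i < k → 1 ≤ N →
         Γ i N ≐ q^ (+ N) · Γ (i ∸ 1) N
                 ⊕ (mono 1 0 (+ 0) ∷ mono 0 1 (+ 0) ∷ mono 0 0 (+ (N ∸ 1))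
                    ∷ mono 1 1 (+ 1 - + N) ∷ []) · E (suc i) (N ∸ 1))
    × (∀ N → 1 ≤ N → E k N ≐ q^ (+ N) · Γ (k ∸ 1) N ⊕ q^ (+ N) · E k N)
    × (∀ i → 0 < i → i ≤ k → E i 0 ≐ oneGF)
    × (∀ N → Γ 0 N ≐ zeroGF)
proposition2 k@(suc k′) (s≤s _) ℰ Γ hE hΓ = E-rec , Γ-rec , E-top , E-base , Γ-base
  where
    E-at : ∀ {i N} h → 0 < i → i ≤ k → k ∸ i ≡ h → IsGFʷ (ℰ i N) (Paths k h N)
    E-at _ 0<i i≤k refl = IsGFʷ-Obj {start = id} {maj} (hE _ _ 0<i i≤k)

    Γ-at : ∀ {i N} h → i < k → k ∸ suc i ≡ h → IsGFʷ (Γ i N) (ΓPaths k h N)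
    Γ-at _ i<k refl = IsGFʷ-Obj {start = NE ∷_} {leftMaj} (hΓ _ _ i<k)

    E-rec : ∀ i N → 0 < i → i < k → 1 ≤ N → ℰ i N ≐ q^ (+ N) · Γ (i ∸ 1) N ⊕ q^ (+ N) · ℰ (suc i) N
    E-rec i@(suc i′) N 0<i i<k 1≤N = E-recurrence (∸-monoʳ-< 0<i (<⇒≤ i<k)) 1≤N
      (E-at _ 0<i (<⇒≤ i<k) refl)
      (Γ-at _ (<-trans (n<1+n i′) i<k) refl)
      (E-at _ (s≤s z≤n) i<k (sym (pred[m∸n]≡m∸[1+n] k i)))

    Γ-rec : ∀ i N → 0 < i → i < k → 1 ≤ N →
         Γ i N ≐ q^ (+ N) · Γ (i ∸ 1) N
                 ⊕ (mono 1 0 (+ 0) ∷ mono 0 1 (+ 0) ∷ mono 0 0 (+ (N ∸ 1))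
                    ∷ mono 1 1 (+ 1 - + N) ∷ []) · ℰ (suc i) (N ∸ 1)
    Γ-rec i@(suc i′) (suc N) 0<i i<k _ = Γ-recurrence (subst (_< k) k∸i≡1+y (∸-monoʳ-< 0<i (<⇒≤ i<k)))
      (Γ-at _ i<k refl)
      (Γ-at _ (<-trans (n<1+n i′) i<k) k∸i≡1+y)
      (E-at _ (s≤s z≤n) i<k refl)
      where
        k∸i≡1+y : k ∸ i ≡ suc (k ∸ suc i)
        k∸i≡1+y = +-∸-assoc 1 i<k

    E-top : ∀ N → 1 ≤ N → ℰ k N ≐ q^ (+ N) · Γ (k ∸ 1) N ⊕ q^ (+ N) · ℰ k N
    E-top N 1≤N = E-recurrence (s≤s z≤n) 1≤N
      (E-at 0 (s≤s z≤n) ≤-refl (n∸n≡0 k′))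
      (Γ-at 0 (n<1+n k′) (n∸n≡0 k′))
      (E-at 0 (s≤s z≤n) ≤-refl (n∸n≡0 k′))

    E-base : ∀ i → 0 < i → i ≤ k → ℰ i 0 ≐ oneGF
    E-base i 0<i i≤k = IsGFʷ-unique (E-at _ 0<i i≤k refl) (IsGFʷ-≃ʷ IsGFʷ-𝟙 (zero-peaks (∸-monoʳ-< 0<i i≤k)))

    Γ-base : ∀ N → Γ 0 N ≐ zeroGF
    Γ-base N = IsGFʷ-unique (Γ-at k′ (s≤s z≤n) refl) (IsGFʷ-empty ΓPaths-top-empty)
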